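{- Let $\Sigma$ be a finite bipartite graph with bipartition classes ${\mathcal E}$ and ${\mathcal O}$, and let $\mu$ be the uniform probability measure on the set of proper $3$-colorings $\chi:V(\Sigma)\to\{0,1,2\}$ of $\Sigma$. Fix ${\mathcal E}'\subseteq{\mathcal E}$ and ${\mathcal O}'\subseteq{\mathcal O}$ arbitrarily. Then for any ${\mathcal E}''\subseteq{\mathcal E}\setminus{\mathcal E}'$ and ${\mathcal O}''\subseteq{\mathcal O}\setminus{\mathcal O}'$, $$\mu\big(\chi\equiv0\text{ on }{\mathcal E}''\text{ and }\chi\equiv1\text{ on }{\mathcal O}''\ \big|\ \chi\equiv0\text{ on }{\mathcal E}'\text{ and }\chi\equiv1\text{ on }{\mathcal O}'\big)\ge3^{ -|{\mathcal E}''\cup{\mathcal O}''|}.$$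
   Context: A proper $3$-coloring of a graph is a map from its vertex set to $\{0,1,2\}$ giving adjacent vertices different colors. -}

module Defs where

import Level
open import Data.Nat using (ℕ; zero; suc)
open import Data.Fin using (Fin; zero; suc)
open import Data.Fin.Subset using (Subset; _∈_)
open import Data.Fin.Subset.Properties using (_∈?_)
open import Data.Fin.Properties using (all?) renaming (_≟_ to _≟F_)
open import Data.Bool using (Bool; true; false)
open import Data.Bool.Properties renaming (_≟_ to _≟B_)
open import Data.Product using (_×_)
open import Data.List using (List; []; _∷_; concatMap; map; length; filter)
open import Relation.Nullary using (Dec; ¬_; ¬?)
open import Relation.Nullary.Decidable using (_×-dec_; _→-dec_)
open import Relation.Unary using (Pred; Decidable)
open import Relation.Binary.PropositionalEquality using (_≡_; _≢_)

record Graph (n : ℕ) : Set where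
  field
    adj    : Fin n → Fin n → Bool
    sym    : ∀ i j → adj i j ≡ adj j i
    irrefl : ∀ i → adj i i ≡ false
open Graph public

-- side i ≡ false : i ∈ 𝓔 ;  side i ≡ true : i ∈ 𝓞.
IsBipartition : ∀ {n} → Graph n → (Fin n → Bool) → Set
IsBipartition G side = ∀ i j → adj G i j ≡ true → side i ≢ side j

Coloring : ℕ → Set
Coloring n = Fin n → Fin 3

Proper : ∀ {n} → Graph n → Coloring n → Set
Proper G χ = ∀ i j → adj G i j ≡ true → χ i ≢ χ j

Pinned : ∀ {n} → Subset n → Subset n → Coloring n → Set
Pinned E O χ = (∀ i → i ∈ E → χ i ≡ zero) × (∀ i → i ∈ O → χ i ≡ suc zero)

consC : ∀ {n} → Fin 3 → Coloring n → Coloring (suc n)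
consC c χ zero    = c
consC c χ (suc i) = χ i

allColorings : (n : ℕ) → List (Coloring n)
allColorings zero    = (λ ()) ∷ []
allColorings (suc n) =
  concatMap (λ c → map (consC c) (allColorings n)) (zero ∷ suc zero ∷ suc (suc zero) ∷ [])

count : ∀ {n} {P : Pred (Coloring n) Level.zero} → Decidable P → ℕ
count {n} P? = length (filter P? (allColorings n))

proper? : ∀ {n} (G : Graph n) → Decidable (Proper G)
proper? G χ = all? λ i → all? λ j → (adj G i j ≟B true) →-dec ¬? (χ i ≟F χ j)

pinned? : ∀ {n} (E O : Subset n) → Decidable (Pinned E O)
pinned? E O χ = (all? λ i → (i ∈? E) →-dec (χ i ≟F zero))
          ×-dec (all? λ i → (i ∈? O) →-dec (χ i ≟F suc zero))

condEvent? : ∀ {n} (G : Graph n) (E O : Subset n) → Decidable (λ χ → Proper G χ × Pinned E O χ)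
condEvent? G E O χ = proper? G χ ×-dec pinned? E O χ

jointEvent? : ∀ {n} (G : Graph n) (E O E₂ O₂ : Subset n) →
  Decidable (λ χ → Proper G χ × Pinned E O χ × Pinned E₂ O₂ χ)
jointEvent? G E O E₂ O₂ χ = proper? G χ ×-dec (pinned? E O χ ×-dec pinned? E₂ O₂ χ)

module Submission where

-- Let Good vs be the proper colourings respecting (E′, O′) that put every
-- vertex of the list vs on its target colour.  For a new vertex v and any colour c,
-- the colourings in Good vs with χ v = c are at most as many as those in
-- Good (v ∷ vs): if c is already the target t of v this is an inclusion, otherwise
-- exchange c and t on the Kempe chain of v (the {c,t}-component containing v).  This
-- is an involution on all colourings; it preserves properness, moves v to t, and by
-- bipartiteness never moves a vertex sitting on its target colour.  Summing over the
-- three values of χ v gives |Good vs| ≤ 3 |Good (v ∷ vs)|, and iterating over the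
-- elements of E″ ∪ O″ gives the lemma.

open import Defs hiding (sym)
open import Level using (0ℓ)
open import Data.Nat using (ℕ; zero; suc; _≤_; _*_; _^_; _+_; z≤n; s≤s)
open import Data.Nat.Properties
  using (≤-refl; ≤-trans; ≤-reflexive; +-mono-≤; +-monoʳ-≤; *-monoʳ-≤; *-assoc; *-comm;
         +-identityʳ; +-assoc; +-0-commutativeMonoid; +-commutativeSemigroup; module ≤-Reasoning)
open import Data.Fin using (Fin; zero; suc; combine; finToFun; funToFin; _↑ˡ_; _↑ʳ_)
open import Data.Fin.Properties using (all?; remQuot-combine; funToFin-finToFin; finToFun-funToFin)
  renaming (_≟_ to _≟F_)
open import Data.Fin.Permutation using (Permutation; permutation)
open import Data.Fin.Subset using (Subset; _∈_; _∉_; _∪_; ∣_∣; inside; outside)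
open import Data.Fin.Subset.Properties using (_∈?_; anySubset?; x∈p∪q⁺)
open import Data.Bool using (Bool; true; false; not; _xor_)
open import Data.Bool.Properties using (¬-not; not-distribˡ-xor; xor-same) renaming (_≟_ to _≟B_)
open import Data.Vec using ([]; _∷_; here; there; tabulate)
open import Data.Vec.Properties using (lookup∘tabulate; lookup⇒[]=; []=⇒lookup)
open import Data.List using (List; []; _∷_; _++_; map; length; filter; concatMap)
open import Data.Nat.ListAction using () renaming (sum to listSum)
open import Data.List.Properties using (filter-++; length-++; length-map; map-cong)
open import Data.List.Membership.Propositional using () renaming (_∈_ to _∈ₗ_)
open import Data.List.Membership.Propositional.Properties using (∈-map⁺)
open import Data.List.Relation.Unary.All as All using (All; []; _∷_)
import Data.List.Relation.Unary.Any as Any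
open import Data.List.Relation.Binary.Sublist.Propositional using (⊆-refl)
open import Data.List.Relation.Binary.Sublist.Propositional.Properties using (filter⁺; length-mono-≤)
open import Data.Product using (_×_; _,_; proj₁; proj₂; ∃)
open import Data.Sum as Sum using (_⊎_; inj₁; inj₂)
open import Data.Empty using (⊥-elim)
open import Function using (_∘_)
open import Relation.Nullary using (Dec; yes; no; ¬_; ¬?; does)
open import Relation.Nullary.Decidable using (_×-dec_; _⊎-dec_; _→-dec_; map′; decidable-stable; dec-true)
open import Relation.Unary using (Pred; Decidable)
open import Relation.Binary.PropositionalEquality
  using (_≡_; _≢_; refl; sym; trans; cong; cong₂; subst; _≗_; module ≡-Reasoning)
open import Algebra.Properties.CommutativeMonoid.Sum +-0-commutativeMonoid
  using (sum; sum-cong-≗; sum-permute)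
open import Algebra.Properties.CommutativeSemigroup +-commutativeSemigroup using (interchange)

indicator : ∀ {A : Set} → Dec A → ℕ
indicator (yes _) = 1
indicator (no _)  = 0

indicator-cong : ∀ {A B : Set} → (A → B) → (B → A) → (a? : Dec A) (b? : Dec B) →
                 indicator a? ≡ indicator b?
indicator-cong A→B B→A (yes _) (yes _) = refl
indicator-cong A→B B→A (yes a) (no ¬b) = ⊥-elim (¬b (A→B a))
indicator-cong A→B B→A (no ¬a) (yes b) = ⊥-elim (¬a (B→A b))
indicator-cong A→B B→A (no _)  (no _)  = refl

indicator-cover : ∀ {A B C : Set} → (A → B ⊎ C) → (a? : Dec A) (b? : Dec B) (c? : Dec C) →
                  indicator a? ≤ indicator b? + indicator c?
indicator-cover cover (no _)  b?      c?      = z≤n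
indicator-cover cover (yes _) (yes _) c?      = s≤s z≤n
indicator-cover cover (yes _) (no _)  (yes _) = ≤-refl
indicator-cover cover (yes a) (no ¬b) (no ¬c) = Sum.[ ⊥-elim ∘ ¬b , ⊥-elim ∘ ¬c ] (cover a)

module _ {A : Set} where

  countIn : {P : Pred A 0ℓ} → Decidable P → List A → ℕ
  countIn P? xs = length (filter P? xs)

  countIn-∷ : {P : Pred A 0ℓ} (P? : Decidable P) (x : A) (xs : List A) →
              countIn P? (x ∷ xs) ≡ indicator (P? x) + countIn P? xs
  countIn-∷ P? x xs with P? x
  ... | yes _ = refl
  ... | no _  = refl

  countIn-++ : {P : Pred A 0ℓ} (P? : Decidable P) (xs ys : List A) →
               countIn P? (xs ++ ys) ≡ countIn P? xs + countIn P? ys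
  countIn-++ P? xs ys = trans (cong length (filter-++ P? xs ys)) (length-++ (filter P? xs))

  countIn-mono : {P Q : Pred A 0ℓ} (P? : Decidable P) (Q? : Decidable Q) →
                 (∀ x → P x → Q x) → (xs : List A) → countIn P? xs ≤ countIn Q? xs
  countIn-mono P? Q? P⊆Q xs = length-mono-≤ (filter⁺ P? Q? (λ { refl → P⊆Q _ }) (⊆-refl {x = xs}))

  countIn-split : {P Q R : Pred A 0ℓ} (P? : Decidable P) (Q? : Decidable Q) (R? : Decidable R) →
                  (∀ x → P x → Q x ⊎ R x) → (xs : List A) →
                  countIn P? xs ≤ countIn Q? xs + countIn R? xs
  countIn-split P? Q? R? cover []       = z≤n
  countIn-split P? Q? R? cover (x ∷ xs) = begin
    countIn P? (x ∷ xs)                           ≡⟨ countIn-∷ P? x xs ⟩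
    indicator (P? x) + countIn P? xs              ≤⟨ +-mono-≤ (indicator-cover (cover x) (P? x) (Q? x) (R? x))
                                                              (countIn-split P? Q? R? cover xs) ⟩
    (indicator (Q? x) + indicator (R? x)) + (countIn Q? xs + countIn R? xs)
                                                  ≡⟨ interchange (indicator (Q? x)) _ _ _ ⟩
    (indicator (Q? x) + countIn Q? xs) + (indicator (R? x) + countIn R? xs)
                                                  ≡⟨ sym (cong₂ _+_ (countIn-∷ Q? x xs) (countIn-∷ R? x xs)) ⟩
    countIn Q? (x ∷ xs) + countIn R? (x ∷ xs)     ∎
    where open ≤-Reasoning

countIn-map : ∀ {A B : Set} {P : Pred B 0ℓ} (P? : Decidable P) (g : A → B) (xs : List A) →
              countIn P? (map g xs) ≡ countIn (P? ∘ g) xs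
countIn-map P? g []       = refl
countIn-map P? g (x ∷ xs) = begin
  countIn P? (g x ∷ map g xs)                  ≡⟨ countIn-∷ P? (g x) (map g xs) ⟩
  indicator (P? (g x)) + countIn P? (map g xs) ≡⟨ cong (indicator (P? (g x)) +_) (countIn-map P? g xs) ⟩
  indicator (P? (g x)) + countIn (P? ∘ g) xs   ≡⟨ sym (countIn-∷ (P? ∘ g) x xs) ⟩
  countIn (P? ∘ g) (x ∷ xs)                    ∎
  where open ≡-Reasoning

countIn-concatMap : ∀ {A B : Set} {P : Pred B 0ℓ} (P? : Decidable P) (f : A → List B) (xs : List A) →
                    countIn P? (concatMap f xs) ≡ listSum (map (countIn P? ∘ f) xs)
countIn-concatMap P? f []       = refl
countIn-concatMap P? f (x ∷ xs) =
  trans (countIn-++ P? (f x) (concatMap f xs)) (cong (countIn P? (f x) +_) (countIn-concatMap P? f xs))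

sum-++ : ∀ N {M} (g : Fin (N + M) → ℕ) →
         sum g ≡ sum (λ i → g (i ↑ˡ M)) + sum (λ j → g (N ↑ʳ j))
sum-++ zero    g = refl
sum-++ (suc N) g = trans (cong (g zero +_) (sum-++ N (g ∘ suc))) (sym (+-assoc (g zero) _ _))

sum-combine : ∀ m {N} (g : Fin (m * N) → ℕ) → sum g ≡ sum (λ c → sum (λ j → g (combine {m} {N} c j)))
sum-combine zero    g = refl
sum-combine (suc m) {N} g =
  trans (sum-++ N g) (cong (sum (λ j → g (j ↑ˡ (m * N))) +_) (sum-combine m (λ k → g (N ↑ʳ k))))

-- Counting colourings: the count is an indicator sum over Fin (3 ^ n), hence
-- invariant under involutions of the set of colourings

Extensional : ∀ {n} → Pred (Coloring n) 0ℓ → Set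
Extensional P = ∀ {χ χ′} → χ ≗ χ′ → P χ → P χ′

consC-cong : ∀ {n} (c : Fin 3) {χ χ′ : Coloring n} → χ ≗ χ′ → consC c χ ≗ consC c χ′
consC-cong c e zero    = refl
consC-cong c e (suc i) = e i

finToFun-combine : ∀ m (c : Fin 3) (j : Fin (3 ^ m)) →
                   finToFun {3} {suc m} (combine c j) ≗ consC c (finToFun j)
finToFun-combine m c j zero    = cong proj₁ (remQuot-combine {3} {3 ^ m} c j)
finToFun-combine m c j (suc i) = cong (λ qr → finToFun (proj₂ qr) i) (remQuot-combine {3} {3 ^ m} c j)

funToFin-cong : ∀ {m k} {f g : Fin m → Fin k} → f ≗ g → funToFin f ≡ funToFin g
funToFin-cong {zero}  e = refl
funToFin-cong {suc m} e = cong₂ combine (e zero) (funToFin-cong (e ∘ suc))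

count-suc : ∀ m {P : Pred (Coloring (suc m)) 0ℓ} (P? : Decidable P) →
            count P? ≡ sum {3} (λ c → count {m} (P? ∘ consC c))
count-suc m P? =
  trans (countIn-concatMap P? (λ (c : Fin 3) → map (consC c) (allColorings m)) colours)
        (cong listSum (map-cong (λ (c : Fin 3) → countIn-map P? (consC c) (allColorings m)) colours))
  where
  colours : List (Fin 3)
  colours = zero ∷ suc zero ∷ suc (suc zero) ∷ []

-- allColorings n lists the decodings of the indices Fin (3 ^ n) in order, up to
-- pointwise equality, so extensional predicates are counted by an indicator sum.
count-as-sum : ∀ n {P : Pred (Coloring n) 0ℓ} (P? : Decidable P) → Extensional P →
               count P? ≡ sum (λ i → indicator (P? (finToFun i)))
count-as-sum zero    P? ext =
  trans (countIn-∷ P? (λ ()) []) (cong (_+ 0) (indicator-cong (ext λ ()) (ext λ ()) _ _))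
count-as-sum (suc m) P? ext = begin
  count P?
    ≡⟨ count-suc m P? ⟩
  sum {3} (λ c → count {m} (P? ∘ consC c))
    ≡⟨ sum-cong-≗ {3} (λ c → count-as-sum m (P? ∘ consC c) (ext ∘ consC-cong c)) ⟩
  sum (λ c → sum {3 ^ m} (λ j → indicator (P? (consC c (finToFun j)))))
    ≡⟨ sum-cong-≗ {3} (λ c → sum-cong-≗ {3 ^ m} (λ j →
         indicator-cong (ext (sym ∘ finToFun-combine m c j)) (ext (finToFun-combine m c j))
                        (P? (consC c (finToFun j))) (P? (finToFun (combine c j))))) ⟩
  sum (λ c → sum {3 ^ m} (λ j → indicator (P? (finToFun (combine {3} {3 ^ m} c j)))))
    ≡⟨ sym (sum-combine 3 {3 ^ m} _) ⟩
  sum (λ i → indicator (P? (finToFun i)))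
    ∎
  where open ≡-Reasoning

module Involution {n} (f : Coloring n → Coloring n)
                  (f-ext : ∀ {χ χ′} → χ ≗ χ′ → f χ ≗ f χ′)
                  (f-involutive : ∀ χ → f (f χ) ≗ χ) where

  index-map : Fin (3 ^ n) → Fin (3 ^ n)
  index-map i = funToFin (f (finToFun i))

  index-map-involutive : ∀ i → index-map (index-map i) ≡ i
  index-map-involutive i = trans
    (funToFin-cong (λ k → trans (f-ext (finToFun-funToFin (f (finToFun i))) k) (f-involutive (finToFun i) k)))
    (funToFin-finToFin {n} {3} i)

  index-permutation : Permutation (3 ^ n) (3 ^ n)
  index-permutation = permutation index-map index-map index-map-involutive index-map-involutive

  count-invariant : {Q : Pred (Coloring n) 0ℓ} (Q? : Decidable Q) → Extensional Q →
                    count (Q? ∘ f) ≡ count Q?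
  count-invariant Q? ext = begin
    count (Q? ∘ f)
      ≡⟨ count-as-sum n (Q? ∘ f) (λ e → ext (f-ext e)) ⟩
    sum (λ i → indicator (Q? (f (finToFun i))))
      ≡⟨ sum-cong-≗ (λ i → indicator-cong (ext (sym ∘ decode i)) (ext (decode i)) _ _) ⟩
    sum (λ i → indicator (Q? (finToFun (index-map i))))
      ≡⟨ sym (sum-permute _ index-permutation) ⟩
    sum (λ i → indicator (Q? (finToFun i)))
      ≡⟨ sym (count-as-sum n Q? ext) ⟩
    count Q?
      ∎
    where
    open ≡-Reasoning
    decode : ∀ i → finToFun (index-map i) ≗ f (finToFun i)
    decode i = finToFun-funToFin (f (finToFun i))

  count-≤ : {P Q : Pred (Coloring n) 0ℓ} (P? : Decidable P) (Q? : Decidable Q) → Extensional Q →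
            (∀ χ → P χ → Q (f χ)) → count P? ≤ count Q?
  count-≤ P? Q? ext P⊆Qf =
    ≤-trans (countIn-mono P? (Q? ∘ f) P⊆Qf (allColorings n)) (≤-reflexive (count-invariant Q? ext))

⟦_⟧ : ∀ {n} {P : Pred (Fin n) 0ℓ} → Decidable P → Subset n
⟦ P? ⟧ = tabulate (does ∘ P?)

∈⟦⟧⁺ : ∀ {n} {P : Pred (Fin n) 0ℓ} (P? : Decidable P) {i} → P i → i ∈ ⟦ P? ⟧
∈⟦⟧⁺ P? {i} p = lookup⇒[]= i ⟦ P? ⟧ (trans (lookup∘tabulate (does ∘ P?) i) (dec-true (P? i) p))

∈⟦⟧⁻ : ∀ {n} {P : Pred (Fin n) 0ℓ} (P? : Decidable P) {i} → i ∈ ⟦ P? ⟧ → P i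
∈⟦⟧⁻ P? {i} i∈ = witness (P? i) (trans (sym (lookup∘tabulate (does ∘ P?) i)) ([]=⇒lookup i∈))
  where
  witness : ∀ {A : Set} (a? : Dec A) → does a? ≡ true → A
  witness (yes a) _ = a

elements : ∀ {n} → Subset n → List (Fin n)
elements []            = []
elements (inside ∷ p)  = zero ∷ map suc (elements p)
elements (outside ∷ p) = map suc (elements p)

length-elements : ∀ {n} (p : Subset n) → length (elements p) ≡ ∣ p ∣
length-elements []            = refl
length-elements (inside ∷ p)  = cong suc (trans (length-map suc (elements p)) (length-elements p))
length-elements (outside ∷ p) = trans (length-map suc (elements p)) (length-elements p)

elements-complete : ∀ {n} (p : Subset n) {i} → i ∈ p → i ∈ₗ elements p
elements-complete (inside ∷ p)  {zero}  _         = Any.here refl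
elements-complete (inside ∷ p)  {suc i} (there m) = Any.there (∈-map⁺ suc (elements-complete p m))
elements-complete (outside ∷ p) {suc i} (there m) = ∈-map⁺ suc (elements-complete p m)

target : Bool → Fin 3
target false = zero
target true  = suc zero

proper-ext : ∀ {n} (G : Graph n) → Extensional (Proper G)
proper-ext G e proper i j ij χ′i≡χ′j = proper i j ij (trans (e i) (trans χ′i≡χ′j (sym (e j))))

pinned-ext : ∀ {n} (E O : Subset n) → Extensional (Pinned E O)
pinned-ext E O e (onE , onO) = (λ i i∈ → trans (sym (e i)) (onE i i∈)) , (λ i i∈ → trans (sym (e i)) (onO i i∈))

pinned-from-targets : ∀ {n} (side : Fin n → Bool) (E O : Subset n) {χ : Coloring n} →
                      (∀ i → i ∈ E → side i ≡ false) → (∀ i → i ∈ O → side i ≡ true) →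
                      All (λ u → χ u ≡ target (side u)) (elements (E ∪ O)) → Pinned E O χ
pinned-from-targets side E O {χ} E-even O-odd onTarget =
  (λ i i∈ → trans (on-target (inj₁ i∈)) (cong target (E-even i i∈))) ,
  (λ i i∈ → trans (on-target (inj₂ i∈)) (cong target (O-odd i i∈)))
  where
  on-target : ∀ {i} → i ∈ E ⊎ i ∈ O → χ i ≡ target (side i)
  on-target {i} i∈ = All.lookup onTarget (elements-complete (E ∪ O) (x∈p∪q⁺ {x = i} i∈))

module KempeChain {n} (G : Graph n) (v : Fin n) (a b : Fin 3) (a≢b : a ≢ b) where

  InAB : Fin 3 → Set
  InAB x = x ≡ a ⊎ x ≡ b

  inAB? : ∀ x → Dec (InAB x)
  inAB? x = (x ≟F a) ⊎-dec (x ≟F b)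

  swap : Fin 3 → Fin 3
  swap x with x ≟F a | x ≟F b
  ... | yes _ | _     = b
  ... | no _  | yes _ = a
  ... | no _  | no _  = x

  swap-a : swap a ≡ b
  swap-a with a ≟F a
  ... | yes _   = refl
  ... | no a≢a = ⊥-elim (a≢a refl)

  swap-b : swap b ≡ a
  swap-b with b ≟F a | b ≟F b
  ... | yes b≡a | _       = ⊥-elim (a≢b (sym b≡a))
  ... | no _    | yes _   = refl
  ... | no _    | no b≢b = ⊥-elim (b≢b refl)

  swap-outside : ∀ {x} → ¬ InAB x → swap x ≡ x
  swap-outside {x} ∉AB with x ≟F a | x ≟F b
  ... | yes x≡a | _       = ⊥-elim (∉AB (inj₁ x≡a))
  ... | no _    | yes x≡b = ⊥-elim (∉AB (inj₂ x≡b))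
  ... | no _    | no _    = refl

  swap-InAB : ∀ {x} → InAB x → InAB (swap x)
  swap-InAB (inj₁ refl) = inj₂ swap-a
  swap-InAB (inj₂ refl) = inj₁ swap-b

  swap-involutive : ∀ x → swap (swap x) ≡ x
  swap-involutive x with inAB? x
  ... | yes (inj₁ refl) = trans (cong swap swap-a) swap-b
  ... | yes (inj₂ refl) = trans (cong swap swap-b) swap-a
  ... | no ∉AB          = trans (cong swap (swap-outside ∉AB)) (swap-outside ∉AB)

  swap-≢ : ∀ {x y} → ¬ InAB y → x ≢ y → swap x ≢ y
  swap-≢ {x} ∉AB x≢y with inAB? x
  ... | yes x∈AB = λ swapx≡y → ∉AB (subst InAB swapx≡y (swap-InAB x∈AB))
  ... | no x∉AB  = λ swapx≡y → x≢y (trans (sym (swap-outside x∉AB)) swapx≡y)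

  swapIf : ∀ {A : Set} → Dec A → Fin 3 → Fin 3
  swapIf (yes _) = swap
  swapIf (no _)  x = x

  swapIf-cong : ∀ {A B : Set} → (A → B) → (B → A) → (a? : Dec A) (b? : Dec B) → ∀ x → swapIf a? x ≡ swapIf b? x
  swapIf-cong A→B B→A (yes _) (yes _) x = refl
  swapIf-cong A→B B→A (yes a) (no ¬b) x = ⊥-elim (¬b (A→B a))
  swapIf-cong A→B B→A (no ¬a) (yes b) x = ⊥-elim (¬a (B→A b))
  swapIf-cong A→B B→A (no _)  (no _)  x = refl

  swapIf-involutive : ∀ {A : Set} (a? : Dec A) x → swapIf a? (swapIf a? x) ≡ x
  swapIf-involutive (yes _) = swap-involutive
  swapIf-involutive (no _)  x = refl

  swapIf-InAB : ∀ {A : Set} (a? : Dec A) {x} → InAB x → InAB (swapIf a? x)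
  swapIf-InAB (yes _) = swap-InAB
  swapIf-InAB (no _)  x∈AB = x∈AB

  InAB-swapIf : ∀ {A : Set} (a? : Dec A) {x} → InAB (swapIf a? x) → InAB x
  InAB-swapIf a? {x} h = subst InAB (swapIf-involutive a? x) (swapIf-InAB a? h)

  Closed : Coloring n → Subset n → Set
  Closed χ S = ∀ w u → w ∈ S → adj G w u ≡ true → InAB (χ u) → u ∈ S

  closed? : ∀ χ S → Dec (Closed χ S)
  closed? χ S = all? λ w → all? λ u →
    (w ∈? S) →-dec ((adj G w u ≟B true) →-dec (inAB? (χ u) →-dec (u ∈? S)))

  -- The Kempe chain of v: the vertices lying in every closed set containing v.
  InChain : Coloring n → Fin n → Set
  InChain χ u = ∀ S → v ∈ S → Closed χ S → u ∈ S

  Separator : Coloring n → Fin n → Subset n → Set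
  Separator χ u S = v ∈ S × Closed χ S × u ∉ S

  inChain? : ∀ χ u → Dec (InChain χ u)
  inChain? χ u = map′ noSeparator→inChain inChain→noSeparator
    (¬? (anySubset? (λ S → (v ∈? S) ×-dec (closed? χ S ×-dec ¬? (u ∈? S)))))
    where
    noSeparator→inChain : ¬ (∃ (Separator χ u)) → InChain χ u
    noSeparator→inChain noSep S v∈S closed =
      decidable-stable (u ∈? S) (λ u∉S → noSep (S , v∈S , closed , u∉S))
    inChain→noSeparator : InChain χ u → ¬ (∃ (Separator χ u))
    inChain→noSeparator inChain (S , v∈S , closed , u∉S) = u∉S (inChain S v∈S closed)

  chain-root : ∀ χ → InChain χ v
  chain-root χ S v∈S _ = v∈S

  chain-closed : ∀ χ {w u} → InChain χ w → adj G w u ≡ true → InAB (χ u) → InChain χ u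
  chain-closed χ {w} {u} w∈ wu u∈AB S v∈S closed = closed w u (w∈ S v∈S closed) wu u∈AB

  chain-mono : ∀ {χ χ′} → (∀ u → InAB (χ u) → InAB (χ′ u)) → ∀ {u} → InChain χ u → InChain χ′ u
  chain-mono χ⊆χ′ u∈ S v∈S closed′ = u∈ S v∈S (λ w u w∈S wu u∈AB → closed′ w u w∈S wu (χ⊆χ′ u u∈AB))

  kempe : Coloring n → Coloring n
  kempe χ u = swapIf (inChain? χ u) (χ u)

  kempe-ext : ∀ {χ χ′} → χ ≗ χ′ → kempe χ ≗ kempe χ′
  kempe-ext {χ} {χ′} e u = trans (cong (swapIf (inChain? χ u)) (e u))
    (swapIf-cong (chain-mono (λ w → subst InAB (e w))) (chain-mono (λ w → subst InAB (sym (e w))))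
                 (inChain? χ u) (inChain? χ′ u) (χ′ u))

  -- Switching keeps the set of a/b-coloured vertices, hence the chain, so it is an involution.
  kempe-involutive : ∀ χ → kempe (kempe χ) ≗ χ
  kempe-involutive χ u = trans
    (swapIf-cong (chain-mono (λ w → InAB-swapIf (inChain? χ w))) (chain-mono (λ w → swapIf-InAB (inChain? χ w)))
                 (inChain? (kempe χ) u) (inChain? χ u) (kempe χ u))
    (swapIf-involutive (inChain? χ u) (χ u))

  kempe-root : ∀ χ → χ v ≡ a → kempe χ v ≡ b
  kempe-root χ χv≡a with inChain? χ v
  ... | yes _     = trans (cong swap χv≡a) swap-a
  ... | no ∉chain = ⊥-elim (∉chain (chain-root χ))

  -- An edge leaving the chain ends at a vertex coloured outside {a, b}, so no clash arises.
  kempe-proper : ∀ χ → Proper G χ → Proper G (kempe χ)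
  kempe-proper χ proper w u wu = switched (inChain? χ w) (inChain? χ u)
    where
    uw : adj G u w ≡ true
    uw = trans (Graph.sym G u w) wu
    switched : (w? : Dec (InChain χ w)) (u? : Dec (InChain χ u)) → swapIf w? (χ w) ≢ swapIf u? (χ u)
    switched (yes _) (yes _) eq = proper w u wu
      (trans (sym (swap-involutive (χ w))) (trans (cong swap eq) (swap-involutive (χ u))))
    switched (yes w∈) (no u∉) = swap-≢ (u∉ ∘ chain-closed χ w∈ wu) (proper w u wu)
    switched (no w∉) (yes u∈) = swap-≢ (w∉ ∘ chain-closed χ u∈ uw) (proper u w uw) ∘ sym
    switched (no _)  (no _)   = proper w u wu

  -- On a bipartite graph the chain of v alternates between a and b across the sides.
  module Bipartite (side : Fin n → Bool) (bip : IsBipartition G side) where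

    pick : Bool → Fin 3
    pick false = a
    pick true  = b

    pick-other : ∀ {x} β → InAB x → x ≢ pick β → x ≡ pick (not β)
    pick-other false (inj₁ x≡a) x≢a = ⊥-elim (x≢a x≡a)
    pick-other false (inj₂ x≡b) _   = x≡b
    pick-other true  (inj₁ x≡a) _   = x≡a
    pick-other true  (inj₂ x≡b) x≢b = ⊥-elim (x≢b x≡b)

    Alternating : Coloring n → Fin n → Set
    Alternating χ u = χ u ≡ pick (side u xor side v)

    alternating-step : ∀ χ → Proper G χ → ∀ {w u} → adj G w u ≡ true → InAB (χ u) →
                       Alternating χ w → Alternating χ u
    alternating-step χ proper {w} {u} wu u∈AB χw = begin
      χ u                                   ≡⟨ pick-other (side w xor side v) u∈AB
                                                 (λ χu≡ → proper w u wu (trans χw (sym χu≡))) ⟩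
      pick (not (side w xor side v))        ≡⟨ cong pick (not-distribˡ-xor (side w) (side v)) ⟩
      pick (not (side w) xor side v)        ≡⟨ cong (λ s → pick (s xor side v)) (sym (¬-not (bip w u wu ∘ sym))) ⟩
      pick (side u xor side v)              ∎
      where open ≡-Reasoning

    -- The alternating vertices form a closed set containing v, so they contain the chain.
    chain-alternates : ∀ χ → Proper G χ → χ v ≡ a → ∀ {u} → InChain χ u → Alternating χ u
    chain-alternates χ proper χv≡a u∈ = ∈⟦⟧⁻ alternating? (u∈ ⟦ alternating? ⟧ v∈ closed)
      where
      alternating? : ∀ u → Dec (Alternating χ u)
      alternating? u = χ u ≟F pick (side u xor side v)
      v∈ : v ∈ ⟦ alternating? ⟧
      v∈ = ∈⟦⟧⁺ alternating? (trans χv≡a (cong pick (sym (xor-same (side v)))))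
      closed : Closed χ ⟦ alternating? ⟧
      closed w u w∈ wu u∈AB = ∈⟦⟧⁺ alternating? (alternating-step χ proper wu u∈AB (∈⟦⟧⁻ alternating? w∈))

    pick-off-target : ∀ s t → b ≡ target t → pick (s xor t) ≢ target s
    pick-off-target false false b≡t eq = a≢b (trans eq (sym b≡t))
    pick-off-target false true  b≡t eq with () ← trans (sym eq) b≡t
    pick-off-target true  false b≡t eq with () ← trans (sym eq) b≡t
    pick-off-target true  true  b≡t eq = a≢b (trans eq (sym b≡t))

    kempe-keeps-targets : b ≡ target (side v) → ∀ χ → Proper G χ → χ v ≡ a →
                          ∀ u → χ u ≡ target (side u) → kempe χ u ≡ χ u
    kempe-keeps-targets b≡t χ proper χv≡a u onTarget with inChain? χ u
    ... | no _   = refl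
    ... | yes u∈ = ⊥-elim (pick-off-target (side u) (side v) b≡t
                             (trans (sym (chain-alternates χ proper χv≡a u∈)) onTarget))

module Pinning {n} (G : Graph n) (side : Fin n → Bool) (bip : IsBipartition G side)
               (E′ O′ : Subset n)
               (E′-even : ∀ i → i ∈ E′ → side i ≡ false)
               (O′-odd : ∀ i → i ∈ O′ → side i ≡ true) where

  OnTarget : Coloring n → Fin n → Set
  OnTarget χ u = χ u ≡ target (side u)

  Good : List (Fin n) → Coloring n → Set
  Good vs χ = Proper G χ × Pinned E′ O′ χ × All (OnTarget χ) vs

  good? : ∀ vs → Decidable (Good vs)
  good? vs χ = proper? G χ ×-dec (pinned? E′ O′ χ ×-dec All.all? (λ u → χ u ≟F target (side u)) vs)

  good-ext : ∀ vs → Extensional (Good vs)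
  good-ext vs e (proper , pinned , onTarget) =
    proper-ext G e proper , pinned-ext E′ O′ e pinned , All.map (λ {u} → trans (sym (e u))) onTarget

  GoodAt : List (Fin n) → Fin n → Fin 3 → Coloring n → Set
  GoodAt vs v c χ = Good vs χ × χ v ≡ c

  good-at? : ∀ vs v c → Decidable (GoodAt vs v c)
  good-at? vs v c χ = good? vs χ ×-dec (χ v ≟F c)

  -- Pinned vertices are on target, so a recolouring fixing on-target vertices keeps the pinning.
  pinned-preserved : ∀ {χ χ′} → Pinned E′ O′ χ → (∀ u → OnTarget χ u → χ′ u ≡ χ u) → Pinned E′ O′ χ′
  pinned-preserved (onE , onO) keep =
    (λ i i∈ → trans (keep i (trans (onE i i∈) (cong target (sym (E′-even i i∈))))) (onE i i∈)) ,
    (λ i i∈ → trans (keep i (trans (onO i i∈) (cong target (sym (O′-odd i i∈))))) (onO i i∈))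

  move-to-target : ∀ vs v c → count (good-at? vs v c) ≤ count (good? (v ∷ vs))
  move-to-target vs v c with c ≟F target (side v)
  ... | yes c≡t = countIn-mono (good-at? vs v c) (good? (v ∷ vs))
                    (λ χ ((proper , pinned , onTarget) , χv≡c) → proper , pinned , trans χv≡c c≡t ∷ onTarget)
                    (allColorings n)
  ... | no c≢t  = Involution.count-≤ kempe kempe-ext kempe-involutive
                    (good-at? vs v c) (good? (v ∷ vs)) (good-ext (v ∷ vs)) switched
    where
    open KempeChain G v c (target (side v)) c≢t
    open Bipartite side bip
    switched : ∀ χ → GoodAt vs v c χ → Good (v ∷ vs) (kempe χ)
    switched χ ((proper , pinned , onTarget) , χv≡c) =
      kempe-proper χ proper , pinned-preserved pinned keep ,
      kempe-root χ χv≡c ∷ All.map (λ {u} h → trans (keep u h) h) onTarget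
      where
      keep : ∀ u → OnTarget χ u → kempe χ u ≡ χ u
      keep = kempe-keeps-targets refl χ proper χv≡c

  colour-cases : (x : Fin 3) → x ≡ zero ⊎ (x ≡ suc zero ⊎ x ≡ suc (suc zero))
  colour-cases zero             = inj₁ refl
  colour-cases (suc zero)       = inj₂ (inj₁ refl)
  colour-cases (suc (suc zero)) = inj₂ (inj₂ refl)

  step : ∀ vs v → count (good? vs) ≤ 3 * count (good? (v ∷ vs))
  step vs v = begin
    count (good? vs)
      ≤⟨ countIn-split (good? vs) (at zero) nonzero? (λ χ g → Sum.map (g ,_) (g ,_) (colour-cases (χ v))) L ⟩
    count (at zero) + count nonzero?
      ≤⟨ +-monoʳ-≤ (count (at zero))
           (countIn-split nonzero? (at (suc zero)) (at (suc (suc zero))) (λ χ (g , e) → Sum.map (g ,_) (g ,_) e) L) ⟩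
    count (at zero) + (count (at (suc zero)) + count (at (suc (suc zero))))
      ≤⟨ +-mono-≤ (move-to-target vs v zero)
                   (+-mono-≤ (move-to-target vs v (suc zero)) (move-to-target vs v (suc (suc zero)))) ⟩
    N + (N + N)
      ≡⟨ cong (λ k → N + (N + k)) (sym (+-identityʳ N)) ⟩
    3 * N
      ∎
    where
    open ≤-Reasoning
    L : List (Coloring n)
    L = allColorings n
    N : ℕ
    N = count (good? (v ∷ vs))
    at : ∀ c → Decidable (GoodAt vs v c)
    at = good-at? vs v
    nonzero? : Decidable (λ χ → Good vs χ × (χ v ≡ suc zero ⊎ χ v ≡ suc (suc zero)))
    nonzero? χ = good? vs χ ×-dec ((χ v ≟F suc zero) ⊎-dec (χ v ≟F suc (suc zero)))

  iterate : ∀ vs → count (good? []) ≤ 3 ^ length vs * count (good? vs)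
  iterate []       = ≤-reflexive (sym (+-identityʳ _))
  iterate (v ∷ vs) = begin
    count (good? [])                          ≤⟨ iterate vs ⟩
    3 ^ length vs * count (good? vs)          ≤⟨ *-monoʳ-≤ (3 ^ length vs) (step vs v) ⟩
    3 ^ length vs * (3 * N)                   ≡⟨ sym (*-assoc (3 ^ length vs) 3 N) ⟩
    3 ^ length vs * 3 * N                     ≡⟨ cong (_* N) (*-comm (3 ^ length vs) 3) ⟩
    3 ^ length (v ∷ vs) * N                   ∎
    where
    open ≤-Reasoning
    N : ℕ
    N = count (good? (v ∷ vs))

-- Iterate over the elements of E″ ∪ O″.
lemma5p1 : ∀ {n} (G : Graph n) (side : Fin n → Bool) → IsBipartition G side →
    (E′ O′ E″ O″ : Subset n) →
    (∀ i → i ∈ E′ → side i ≡ false) →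
    (∀ i → i ∈ O′ → side i ≡ true) →
    (∀ i → i ∈ E″ → side i ≡ false × i ∉ E′) →
    (∀ i → i ∈ O″ → side i ≡ true × i ∉ O′) →
    count (condEvent? G E′ O′) ≤ 3 ^ ∣ E″ ∪ O″ ∣ * count (jointEvent? G E′ O′ E″ O″)
lemma5p1 {n} G side bip E′ O′ E″ O″ E′-even O′-odd E″-even O″-odd = begin
  count (condEvent? G E′ O′)
    ≤⟨ countIn-mono (condEvent? G E′ O′) (good? []) (λ χ (proper , pinned) → proper , pinned , []) L ⟩
  count (good? [])
    ≤⟨ iterate vs ⟩
  3 ^ length vs * count (good? vs)
    ≤⟨ *-monoʳ-≤ (3 ^ length vs) (countIn-mono (good? vs) (jointEvent? G E′ O′ E″ O″) newly-pinned L) ⟩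
  3 ^ length vs * count (jointEvent? G E′ O′ E″ O″)
    ≡⟨ cong (λ k → 3 ^ k * count (jointEvent? G E′ O′ E″ O″)) (length-elements (E″ ∪ O″)) ⟩
  3 ^ ∣ E″ ∪ O″ ∣ * count (jointEvent? G E′ O′ E″ O″)
    ∎
  where
  open ≤-Reasoning
  open Pinning G side bip E′ O′ E′-even O′-odd
  L : List (Coloring n)
  L = allColorings n
  vs : List (Fin n)
  vs = elements (E″ ∪ O″)
  newly-pinned : ∀ χ → Good vs χ → Proper G χ × Pinned E′ O′ χ × Pinned E″ O″ χ
  newly-pinned χ (proper , pinned , onTarget) =
    proper , pinned , pinned-from-targets side E″ O″ (λ i → proj₁ ∘ E″-even i) (λ i → proj₁ ∘ O″-odd i) onTarget
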